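{- Let $n>1$ and let $\alpha=\sqrt{n}\begin{pmatrix} A & \frac{B}{n}\\ C & -A\end{pmatrix}$ and $\alpha'=\sqrt{n}\begin{pmatrix} A' & \frac{B'}{n}\\ C' & -A'\end{pmatrix}$ with $A,B,C,A',B',C'\in\mathbb{Z}$, $nA^2+BC=nA'^2+B'C'=-1$, $B,B'<0$, $C,C'>0$. Define the binary quadratic forms $F_\alpha(x,y)=nCx^2-2nAxy-By^2$ and $F_{\alpha'}(x,y)=nC'x^2-2nA'xy-B'y^2$. Then $F_\alpha$ and $F_{\alpha'}$ are $\mathrm{SL}_2(\mathbb{Z})$-equivalent (properly equivalent) if and only if $\alpha$ and $\alpha'$ are conjugate in $\Gamma_0(n)^\dagger$. Moreover, if $\alpha$ and $\alpha'$ are conjugate in $\Gamma_0(n)^\dagger$, then there exists $\delta\in\Gamma_0(n)$ with $\delta^{ -1}\alpha\delta=\alpha'$.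
   Context: $\Gamma_0(n)\subset\mathrm{PSL}_2(\mathbb{Z})$ is the usual congruence subgroup; the Fricke group $\Gamma_0(n)^\dagger\subset\mathrm{PSL}_2(\mathbb{R})$ is generated by $\Gamma_0(n)$ and $w_n=\sqrt{n}\begin{pmatrix}0&-1/n\\1&0\end{pmatrix}$, and $\Gamma_0(n)$ has index $2$ in it. Conjugacy is computed in $\Gamma_0(n)^\dagger\subset\mathrm{PSL}_2(\mathbb{R})$, i.e. matrices are taken modulo $\pm1$. The forms $F_\alpha$ are positive definite of discriminant $-4n$. -}

module Defs where

open import Data.Nat using (ℕ)
open import Data.Integer using (ℤ; +_; _+_; _*_; -_; _-_)
open import Data.Integer.Divisibility using (_∣_)
open import Data.Product using (Σ; ∃; _×_; _,_)
open import Data.Sum using (_⊎_)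
open import Relation.Binary.PropositionalEquality using (_≡_)

record Mat : Set where
  constructor mat
  field
    a b c d : ℤ

open Mat public

_·_ : Mat → Mat → Mat
mat a₁ b₁ c₁ d₁ · mat a₂ b₂ c₂ d₂ =
  mat (a₁ * a₂ + b₁ * c₂) (a₁ * b₂ + b₁ * d₂)
      (c₁ * a₂ + d₁ * c₂) (c₁ * b₂ + d₁ * d₂)

negM : Mat → Mat
negM (mat a b c d) = mat (- a) (- b) (- c) (- d)

det : Mat → ℤ
det (mat a b c d) = a * d - b * c

InSL2 : Mat → Set
InSL2 G = det G ≡ + 1

InΓ₀ : ℕ → Mat → Set
InΓ₀ n G = det G ≡ + 1 × (+ n) ∣ c G

-- The non-trivial coset w_n Γ₀(n) of Γ₀(n) in Γ₀(n)†: its elements are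
-- exactly the real matrices (1/√n)·G with G = (n x, y ; n z, n w) ∈ M₂(ℤ),
-- det G = n.  We record the integer matrix G.
InWnCoset : ℕ → Mat → Set
InWnCoset n G = det G ≡ + n × (+ n) ∣ a G × (+ n) ∣ c G × (+ n) ∣ d G

-- Elements of the Fricke group Γ₀(n)† (as elements of SL₂(ℝ), before
-- passing to PSL₂): an element of Γ₀(n), or (1/√n)·G with G as above.
data Fricke (n : ℕ) : Set where
  ev : (G : Mat) → InΓ₀ n G → Fricke n
  od : (G : Mat) → InWnCoset n G → Fricke n

intMat : {n : ℕ} → Fricke n → Mat
intMat (ev G _) = G
intMat (od G _) = G

-- α = √n (A, B/n ; C, -A) = (1/√n)·(nA, B ; nC, -nA);  we record the
-- integer matrix (nA, B ; nC, -nA).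
αInt : ℕ → ℤ → ℤ → ℤ → Mat
αInt n A B C = mat (+ n * A) B (+ n * C) (- (+ n * A))

-- For g = s·G (s ∈ {1, 1/√n}) and α = (1/√n)·M, α' = (1/√n)·M',
-- the PSL₂(ℝ) identity g⁻¹ α g = α' (i.e. g⁻¹αg = ±α' in SL₂(ℝ)) is
-- equivalent to  G M' = ± M G  (scalars cancel on both sides).
ConjBy : Mat → Mat → Mat → Set
ConjBy G M M' = (G · M' ≡ M · G) ⊎ (G · M' ≡ negM (M · G))

ConjFricke : ℕ → Mat → Mat → Set
ConjFricke n M M' = Σ (Fricke n) λ g → ConjBy (intMat g) M M'

ConjΓ₀ : ℕ → Mat → Mat → Set
ConjΓ₀ n M M' = Σ Mat λ δ → InΓ₀ n δ × ConjBy δ M M'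

record BQF : Set where
  constructor bqf
  field
    f g h : ℤ

eval : BQF → ℤ → ℤ → ℤ
eval (bqf f g h) x y = f * x * x + g * x * y + h * y * y

ProperlyEquiv : BQF → BQF → Set
ProperlyEquiv F F' = Σ Mat λ γ → InSL2 γ ×
  (∀ x y → eval F' x y ≡ eval F (a γ * x + b γ * y) (c γ * x + d γ * y))

Fα : ℕ → ℤ → ℤ → ℤ → BQF
Fα n A B C = bqf (+ n * C) (- (+ 2 * + n * A)) (- B)

-- F_α(v) = det (v | α v), and for γ ∈ SL₂(ℤ) the form F_α ∘ γ is the form of adj γ · α · γ.
-- A traceless matrix is determined by its form, so F_α ∘ γ = F_α′ exactly when γ α′ = α γ;
-- the (1,1) entry of that identity gives n ∣ B c(γ), hence n ∣ c(γ) because B C ≡ −1 (mod n).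
-- A conjugator (1/√n) G from the odd coset becomes one in Γ₀(n) after multiplying by α itself,
-- since α G is n times an integral matrix.  Conjugation up to the sign −1 is impossible:
-- it would carry the positive definite F_α to the negative definite −F_α′.

module Submission where

open import Defs
open import Data.Nat using (ℕ)
open import Data.Integer using (ℤ; +_; _+_; _*_; -_; _<_)
open import Data.Product using (_×_)
open import Function.Bundles using (_⇔_)
open import Relation.Binary.PropositionalEquality using (_≡_)

open import Data.Empty using (⊥-elim)
open import Data.Integer using (-[1+_]; +≤+; +<+; _-_; _≤_; 0ℤ; -1ℤ; NonZero; positive)
open import Data.Integer.Divisibility.Signed
  using (divides; ∣⇒∣ᵤ; ∣ᵤ⇒∣; ∣-refl; ∣m⇒∣m*n; ∣n⇒∣m*n; ∣m∣n⇒∣m+n; ∣m⇒∣-m)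
  renaming (_∣_ to _∣ₛ_)
open import Data.Integer.Properties
  using (*-cancelˡ-≡; *-identityˡ; *-identityʳ; *-zeroʳ; *-cancelˡ-≤-pos; *-monoˡ-<-pos;
         *-monoˡ-≤-nonNeg; +-mono-≤; +-inverseʳ; <⇒≱; neg-mono-<; neg-injective;
         neg-involutive; neg-distribʳ-*; -1*i≡-i; pos-*; module ≤-Reasoning)
open import Data.Integer.Tactic.RingSolver using (solve-∀)
import Data.Nat as ℕ
import Data.Nat.Properties as ℕₚ
open import Data.Product using (Σ; _,_)
open import Data.Sum using (_⊎_; inj₁; inj₂; [_,_])
open import Function.Base using (id)
open import Function.Bundles using (mk⇔)
open import Relation.Binary.PropositionalEquality
  using (_≢_; refl; sym; trans; cong; cong₂; subst; module ≡-Reasoning)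

mat-cong : ∀ {a b c d a′ b′ c′ d′} → a ≡ a′ → b ≡ b′ → c ≡ c′ → d ≡ d′ →
           mat a b c d ≡ mat a′ b′ c′ d′
mat-cong refl refl refl refl = refl

bqf-cong : ∀ {f g h f′ g′ h′} → f ≡ f′ → g ≡ g′ → h ≡ h′ → bqf f g h ≡ bqf f′ g′ h′
bqf-cong refl refl refl = refl

infix 6 _⋆_

_⋆_ : ℤ → Mat → Mat
k ⋆ mat a b c d = mat (k * a) (k * b) (k * c) (k * d)

adj : Mat → Mat
adj (mat a b c d) = mat d (- b) (- c) a

trace : Mat → ℤ
trace (mat a b c d) = a + d

_⊳_ : Mat → ℤ × ℤ → ℤ × ℤ
mat a b c d ⊳ (x , y) = a * x + b * y , c * x + d * y

ω : ℤ × ℤ → ℤ × ℤ → ℤ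
ω (x , y) (x′ , y′) = x * y′ - y * x′

row-col-assoc : ∀ p r q s t w u v →
  (p * q + r * s) * u + (p * t + r * w) * v ≡ p * (q * u + t * v) + r * (s * u + w * v)
row-col-assoc = solve-∀

·-assoc : ∀ F G H → (F · G) · H ≡ F · (G · H)
·-assoc (mat a₁ b₁ c₁ d₁) (mat a₂ b₂ c₂ d₂) (mat a₃ b₃ c₃ d₃) =
  mat-cong (entry a₁ b₁ a₃ c₃) (entry a₁ b₁ b₃ d₃) (entry c₁ d₁ a₃ c₃) (entry c₁ d₁ b₃ d₃)
  where entry = λ p r u v → row-col-assoc p r a₂ c₂ b₂ d₂ u v

·-⊳ : ∀ F G v → (F · G) ⊳ v ≡ F ⊳ (G ⊳ v)
·-⊳ (mat a₁ b₁ c₁ d₁) (mat a₂ b₂ c₂ d₂) (x , y) =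
  cong₂ _,_ (row-col-assoc a₁ b₁ a₂ c₂ b₂ d₂ x y) (row-col-assoc c₁ d₁ a₂ c₂ b₂ d₂ x y)

det-· : ∀ F G → det (F · G) ≡ det F * det G
det-· (mat a₁ b₁ c₁ d₁) (mat a₂ b₂ c₂ d₂) = identity a₁ b₁ c₁ d₁ a₂ b₂ c₂ d₂
  where
  identity : ∀ a₁ b₁ c₁ d₁ a₂ b₂ c₂ d₂ →
    (a₁ * a₂ + b₁ * c₂) * (c₁ * b₂ + d₁ * d₂) - (a₁ * b₂ + b₁ * d₂) * (c₁ * a₂ + d₁ * c₂) ≡
    (a₁ * d₁ - b₁ * c₁) * (a₂ * d₂ - b₂ * c₂)
  identity = solve-∀

det-⋆ : ∀ k F → det (k ⋆ F) ≡ k * (k * det F)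
det-⋆ k (mat a b c d) = identity k a b c d
  where
  identity : ∀ k a b c d → k * a * (k * d) - k * b * (k * c) ≡ k * (k * (a * d - b * c))
  identity = solve-∀

⋆-·ˡ : ∀ k F G → (k ⋆ F) · G ≡ k ⋆ (F · G)
⋆-·ˡ k (mat a₁ b₁ c₁ d₁) (mat a₂ b₂ c₂ d₂) =
  mat-cong (entry k a₁ b₁ a₂ c₂) (entry k a₁ b₁ b₂ d₂) (entry k c₁ d₁ a₂ c₂) (entry k c₁ d₁ b₂ d₂)
  where
  entry : ∀ k p r q s → k * p * q + k * r * s ≡ k * (p * q + r * s)
  entry = solve-∀

⋆-·ʳ : ∀ k F G → F · (k ⋆ G) ≡ k ⋆ (F · G)
⋆-·ʳ k (mat a₁ b₁ c₁ d₁) (mat a₂ b₂ c₂ d₂) =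
  mat-cong (entry k a₁ b₁ a₂ c₂) (entry k a₁ b₁ b₂ d₂) (entry k c₁ d₁ a₂ c₂) (entry k c₁ d₁ b₂ d₂)
  where
  entry : ∀ k p r q s → p * (k * q) + r * (k * s) ≡ k * (p * q + r * s)
  entry = solve-∀

negM-·ʳ : ∀ F G → F · negM G ≡ negM (F · G)
negM-·ʳ (mat a₁ b₁ c₁ d₁) (mat a₂ b₂ c₂ d₂) =
  mat-cong (entry a₁ b₁ a₂ c₂) (entry a₁ b₁ b₂ d₂) (entry c₁ d₁ a₂ c₂) (entry c₁ d₁ b₂ d₂)
  where
  entry : ∀ p r q s → p * - q + r * - s ≡ - (p * q + r * s)
  entry = solve-∀

negM-⋆ : ∀ k F → negM (k ⋆ F) ≡ k ⋆ negM F
negM-⋆ k (mat a b c d) =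
  mat-cong (neg-distribʳ-* k a) (neg-distribʳ-* k b) (neg-distribʳ-* k c) (neg-distribʳ-* k d)

negM-involutive : ∀ F → negM (negM F) ≡ F
negM-involutive (mat a b c d) =
  mat-cong (neg-involutive a) (neg-involutive b) (neg-involutive c) (neg-involutive d)

⋆-identityˡ : ∀ F → + 1 ⋆ F ≡ F
⋆-identityˡ (mat a b c d) = mat-cong (*-identityˡ a) (*-identityˡ b) (*-identityˡ c) (*-identityˡ d)

⋆-cancelˡ : ∀ k {F G} .{{_ : NonZero k}} → k ⋆ F ≡ k ⋆ G → F ≡ G
⋆-cancelˡ k {mat a b c d} {mat a′ b′ c′ d′} eq = mat-cong
  (*-cancelˡ-≡ k a a′ (cong Mat.a eq)) (*-cancelˡ-≡ k b b′ (cong Mat.b eq))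
  (*-cancelˡ-≡ k c c′ (cong Mat.c eq)) (*-cancelˡ-≡ k d d′ (cong Mat.d eq))

adj-·-cancelˡ : ∀ γ F → adj γ · (γ · F) ≡ det γ ⋆ F
adj-·-cancelˡ (mat a b c d) (mat p q r s) =
  mat-cong (top a b c d p r) (top a b c d q s) (bottom a b c d p r) (bottom a b c d q s)
  where
  top : ∀ a b c d p r → d * (a * p + b * r) + - b * (c * p + d * r) ≡ (a * d - b * c) * p
  top = solve-∀
  bottom : ∀ a b c d p r → - c * (a * p + b * r) + a * (c * p + d * r) ≡ (a * d - b * c) * r
  bottom = solve-∀

·-adj-cancelˡ : ∀ γ F → γ · (adj γ · F) ≡ det γ ⋆ F
·-adj-cancelˡ (mat a b c d) (mat p q r s) =
  mat-cong (top a b c d p r) (top a b c d q s) (bottom a b c d p r) (bottom a b c d q s)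
  where
  top : ∀ a b c d p r → a * (d * p + - b * r) + b * (- c * p + a * r) ≡ (a * d - b * c) * p
  top = solve-∀
  bottom : ∀ a b c d p r → c * (d * p + - b * r) + d * (- c * p + a * r) ≡ (a * d - b * c) * r
  bottom = solve-∀

adj-·-cancelˡ-SL₂ : ∀ γ → det γ ≡ + 1 → ∀ F → adj γ · (γ · F) ≡ F
adj-·-cancelˡ-SL₂ γ detγ F = trans (adj-·-cancelˡ γ F) (trans (cong (_⋆ F) detγ) (⋆-identityˡ F))

trace-adj-conj : ∀ γ M → trace (adj γ · (M · γ)) ≡ det γ * trace M
trace-adj-conj (mat a b c d) (mat p q r s) = identity a b c d p q r s
  where
  identity : ∀ a b c d p q r s →
    d * (p * a + q * c) + - b * (r * a + s * c) + (- c * (p * b + q * d) + a * (r * b + s * d)) ≡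
    (a * d - b * c) * (p + s)
  identity = solve-∀

ω-⊳-adj : ∀ γ v w → ω (γ ⊳ v) w ≡ ω v (adj γ ⊳ w)
ω-⊳-adj (mat a b c d) (x , y) (x′ , y′) = identity a b c d x y x′ y′
  where
  identity : ∀ a b c d x y x′ y′ →
    (a * x + b * y) * y′ - (c * x + d * y) * x′ ≡ x * (- c * x′ + a * y′) - y * (d * x′ + - b * y′)
  identity = solve-∀

ConjBy-·ˡ : ∀ G M M′ → ConjBy G M M′ → ConjBy (M · G) M M′
ConjBy-·ˡ G M M′ (inj₁ eq) = inj₁ (begin
  (M · G) · M′  ≡⟨ ·-assoc M G M′ ⟩
  M · (G · M′)  ≡⟨ cong (M ·_) eq ⟩
  M · (M · G)   ∎)
  where open ≡-Reasoning
ConjBy-·ˡ G M M′ (inj₂ eq) = inj₂ (begin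
  (M · G) · M′      ≡⟨ ·-assoc M G M′ ⟩
  M · (G · M′)      ≡⟨ cong (M ·_) eq ⟩
  M · negM (M · G)  ≡⟨ negM-·ʳ M (M · G) ⟩
  negM (M · (M · G)) ∎)
  where open ≡-Reasoning

ConjBy-⋆-cancel : ∀ k δ M M′ .{{_ : NonZero k}} → ConjBy (k ⋆ δ) M M′ → ConjBy δ M M′
ConjBy-⋆-cancel k δ M M′ (inj₁ eq) = inj₁ (⋆-cancelˡ k (begin
  k ⋆ (δ · M′)  ≡⟨ sym (⋆-·ˡ k δ M′) ⟩
  (k ⋆ δ) · M′  ≡⟨ eq ⟩
  M · (k ⋆ δ)   ≡⟨ ⋆-·ʳ k M δ ⟩
  k ⋆ (M · δ)   ∎))
  where open ≡-Reasoning
ConjBy-⋆-cancel k δ M M′ (inj₂ eq) = inj₂ (⋆-cancelˡ k (begin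
  k ⋆ (δ · M′)        ≡⟨ sym (⋆-·ˡ k δ M′) ⟩
  (k ⋆ δ) · M′        ≡⟨ eq ⟩
  negM (M · (k ⋆ δ))  ≡⟨ cong negM (⋆-·ʳ k M δ) ⟩
  negM (k ⋆ (M · δ))  ≡⟨ negM-⋆ k (M · δ) ⟩
  k ⋆ negM (M · δ)    ∎))
  where open ≡-Reasoning

ConjBy⇒adj-conj : ∀ γ M M′ → det γ ≡ + 1 → ConjBy γ M M′ →
                  adj γ · (M · γ) ≡ M′ ⊎ adj γ · (M · γ) ≡ negM M′
ConjBy⇒adj-conj γ M M′ detγ (inj₁ eq) = inj₁ (begin
  adj γ · (M · γ)   ≡⟨ cong (adj γ ·_) (sym eq) ⟩
  adj γ · (γ · M′)  ≡⟨ adj-·-cancelˡ-SL₂ γ detγ M′ ⟩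
  M′                ∎)
  where open ≡-Reasoning
ConjBy⇒adj-conj γ M M′ detγ (inj₂ eq) = inj₂ (begin
  adj γ · (M · γ)              ≡⟨ cong (adj γ ·_) (negM-involutive (M · γ)) ⟨
  adj γ · negM (negM (M · γ))  ≡⟨ cong (λ G → adj γ · negM G) eq ⟨
  adj γ · negM (γ · M′)        ≡⟨ negM-·ʳ (adj γ) (γ · M′) ⟩
  negM (adj γ · (γ · M′))      ≡⟨ cong negM (adj-·-cancelˡ-SL₂ γ detγ M′) ⟩
  negM M′                      ∎)
  where open ≡-Reasoning

adj-conj⇒commute : ∀ γ M M′ → det γ ≡ + 1 → adj γ · (M · γ) ≡ M′ → γ · M′ ≡ M · γ
adj-conj⇒commute γ M M′ detγ eq = begin
  γ · M′                   ≡⟨ cong (γ ·_) (sym eq) ⟩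
  γ · (adj γ · (M · γ))    ≡⟨ ·-adj-cancelˡ γ (M · γ) ⟩
  det γ ⋆ (M · γ)          ≡⟨ cong (_⋆ (M · γ)) detγ ⟩
  + 1 ⋆ (M · γ)            ≡⟨ ⋆-identityˡ (M · γ) ⟩
  M · γ                    ∎
  where open ≡-Reasoning

formOf : Mat → BQF
formOf (mat a b c d) = bqf c (d - a) (- b)

eval-formOf : ∀ M x y → eval (formOf M) x y ≡ ω (x , y) (M ⊳ (x , y))
eval-formOf (mat a b c d) x y = identity a b c d x y
  where
  identity : ∀ a b c d x y →
    c * x * x + (d - a) * x * y + - b * y * y ≡ x * (c * x + d * y) - y * (a * x + b * y)
  identity = solve-∀

eval-formOf-adj-conj : ∀ γ M x y →
  eval (formOf (adj γ · (M · γ))) x y ≡ eval (formOf M) (a γ * x + b γ * y) (c γ * x + d γ * y)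
eval-formOf-adj-conj γ M x y = begin
  eval (formOf (adj γ · (M · γ))) x y  ≡⟨ eval-formOf (adj γ · (M · γ)) x y ⟩
  ω v ((adj γ · (M · γ)) ⊳ v)          ≡⟨ cong (ω v) (·-⊳ (adj γ) (M · γ) v) ⟩
  ω v (adj γ ⊳ ((M · γ) ⊳ v))          ≡⟨ ω-⊳-adj γ v ((M · γ) ⊳ v) ⟨
  ω (γ ⊳ v) ((M · γ) ⊳ v)              ≡⟨ cong (ω (γ ⊳ v)) (·-⊳ M γ v) ⟩
  ω (γ ⊳ v) (M ⊳ (γ ⊳ v))              ≡⟨ eval-formOf M _ _ ⟨
  eval (formOf M) (a γ * x + b γ * y) (c γ * x + d γ * y) ∎
  where
  open ≡-Reasoning
  v = x , y

eval-formOf-negM : ∀ M → eval (formOf (negM M)) (+ 1) 0ℤ ≡ - c M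
eval-formOf-negM (mat a b c d) = identity a b c d
  where
  identity : ∀ a b c d → - c * + 1 * + 1 + (- d - - a) * + 1 * 0ℤ + - - b * 0ℤ * 0ℤ ≡ - c
  identity = solve-∀

eval-injective : ∀ F G → (∀ x y → eval F x y ≡ eval G x y) → F ≡ G
eval-injective F@(bqf f g h) G@(bqf f′ g′ h′) agree = bqf-cong f≡f′ g≡g′ h≡h′
  where
  open ≡-Reasoning
  at-1-0 : ∀ f g h → f * + 1 * + 1 + g * + 1 * 0ℤ + h * 0ℤ * 0ℤ ≡ f
  at-1-0 = solve-∀
  at-0-1 : ∀ f g h → f * 0ℤ * 0ℤ + g * 0ℤ * + 1 + h * + 1 * + 1 ≡ h
  at-0-1 = solve-∀
  at-1-1 : ∀ f g h → f * + 1 * + 1 + g * + 1 * + 1 + h * + 1 * + 1 - f - h ≡ g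
  at-1-1 = solve-∀
  f≡f′ : f ≡ f′
  f≡f′ = trans (sym (at-1-0 f g h)) (trans (agree (+ 1) 0ℤ) (at-1-0 f′ g′ h′))
  h≡h′ : h ≡ h′
  h≡h′ = trans (sym (at-0-1 f g h)) (trans (agree 0ℤ (+ 1)) (at-0-1 f′ g′ h′))
  g≡g′ : g ≡ g′
  g≡g′ = begin
    g                              ≡⟨ at-1-1 f g h ⟨
    eval F (+ 1) (+ 1) - f - h     ≡⟨ cong₂ (λ e u → e - u - h) (agree (+ 1) (+ 1)) f≡f′ ⟩
    eval G (+ 1) (+ 1) - f′ - h    ≡⟨ cong (λ u → eval G (+ 1) (+ 1) - f′ - u) h≡h′ ⟩
    eval G (+ 1) (+ 1) - f′ - h′   ≡⟨ at-1-1 f′ g′ h′ ⟩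
    g′                             ∎

formOf-injective : ∀ M M′ → trace M ≡ 0ℤ → trace M′ ≡ 0ℤ → formOf M ≡ formOf M′ → M ≡ M′
formOf-injective (mat a b c d) (mat a′ b′ c′ d′) tr tr′ eq =
  mat-cong a≡a′ (neg-injective (cong BQF.h eq)) (cong BQF.f eq) d≡d′
  where
  open ≡-Reasoning
  twice : ∀ a d → + 2 * a ≡ (a + d) - (d - a)
  twice = solve-∀
  cancel : ∀ a d → (a + d) - a ≡ d
  cancel = solve-∀
  a≡a′ : a ≡ a′
  a≡a′ = *-cancelˡ-≡ (+ 2) a a′ (begin
    + 2 * a               ≡⟨ twice a d ⟩
    (a + d) - (d - a)     ≡⟨ cong₂ _-_ (trans tr (sym tr′)) (cong BQF.g eq) ⟩
    (a′ + d′) - (d′ - a′) ≡⟨ twice a′ d′ ⟨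
    + 2 * a′              ∎)
  d≡d′ : d ≡ d′
  d≡d′ = begin
    d               ≡⟨ cancel a d ⟨
    (a + d) - a     ≡⟨ cong₂ _-_ (trans tr (sym tr′)) a≡a′ ⟩
    (a′ + d′) - a′  ≡⟨ cancel a′ d′ ⟩
    d′              ∎

ProperlyEquiv-formOf⇒commute : ∀ M M′ → trace M ≡ 0ℤ → trace M′ ≡ 0ℤ →
  ProperlyEquiv (formOf M) (formOf M′) → Σ Mat λ γ → det γ ≡ + 1 × γ · M′ ≡ M · γ
ProperlyEquiv-formOf⇒commute M M′ tr tr′ (γ , detγ , F′≡F∘γ) =
  γ , detγ , adj-conj⇒commute γ M M′ detγ (formOf-injective _ M′ traceless tr′ (sym forms))
  where
  forms : formOf M′ ≡ formOf (adj γ · (M · γ))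
  forms = eval-injective _ _ λ x y → trans (F′≡F∘γ x y) (sym (eval-formOf-adj-conj γ M x y))
  traceless : trace (adj γ · (M · γ)) ≡ 0ℤ
  traceless = trans (trace-adj-conj γ M) (trans (cong (det γ *_) tr) (*-zeroʳ (det γ)))

adj-conj⇒ProperlyEquiv : ∀ γ M M′ → det γ ≡ + 1 → adj γ · (M · γ) ≡ M′ →
                         ProperlyEquiv (formOf M) (formOf M′)
adj-conj⇒ProperlyEquiv γ M M′ detγ eq = γ , detγ , λ x y →
  trans (cong (λ N → eval (formOf N) x y) (sym eq)) (eval-formOf-adj-conj γ M x y)

square-nonNeg : ∀ i → 0ℤ ≤ i * i
square-nonNeg (+ n)    = subst (0ℤ ≤_) (pos-* n n) (+≤+ ℕ.z≤n)
square-nonNeg -[1+ n ] = +≤+ ℕ.z≤n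

*-pos : ∀ {i j} → 0ℤ < i → 0ℤ < j → 0ℤ < i * j
*-pos {i} {j} 0<i 0<j = subst (_< i * j) (*-zeroʳ i) (*-monoˡ-<-pos i {{positive 0<i}} 0<j)

trace-αInt : ∀ n A B C → trace (αInt n A B C) ≡ 0ℤ
trace-αInt n A B C = +-inverseʳ (+ n * A)

det-αInt : ∀ n A B C → + n * (A * A) + B * C ≡ -1ℤ → det (αInt n A B C) ≡ + n
det-αInt n A B C unit = begin
  N * A * - (N * A) - B * (N * C) ≡⟨ expand N A B C ⟩
  - (N * (N * (A * A) + B * C))   ≡⟨ cong (λ u → - (N * u)) unit ⟩
  - (N * -1ℤ)                     ≡⟨ unit-sign N ⟩
  N                               ∎
  where
  open ≡-Reasoning
  N = + n
  expand : ∀ N A B C → N * A * - (N * A) - B * (N * C) ≡ - (N * (N * (A * A) + B * C))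
  expand = solve-∀
  unit-sign : ∀ N → - (N * -1ℤ) ≡ N
  unit-sign = solve-∀

Fα≡formOf-αInt : ∀ n A B C → Fα n A B C ≡ formOf (αInt n A B C)
Fα≡formOf-αInt n A B C = cong (λ g → bqf (+ n * C) g (- B)) (doubling (+ n) A)
  where
  doubling : ∀ N A → - (+ 2 * N * A) ≡ - (N * A) - N * A
  doubling = solve-∀

formOf-αInt-nonNeg : ∀ n A B C → 0ℤ < + n → + n * (A * A) + B * C ≡ -1ℤ → 0ℤ < C →
                     ∀ x y → 0ℤ ≤ eval (formOf (αInt n A B C)) x y
formOf-αInt-nonNeg n A B C 0<n unit 0<C x y =
  *-cancelˡ-≤-pos 0ℤ _ (N * C) {{positive (*-pos 0<n 0<C)}} (begin
    N * C * 0ℤ                                ≡⟨ *-zeroʳ (N * C) ⟩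
    0ℤ                                        ≤⟨ +-mono-≤ (square-nonNeg X) N*y²-nonNeg ⟩
    X * X + N * (y * y)                       ≡⟨ completed-square ⟨
    N * C * eval (formOf (αInt n A B C)) x y  ∎)
  where
  open ≤-Reasoning
  N = + n
  X = N * C * x - N * A * y
  N*y²-nonNeg : 0ℤ ≤ N * (y * y)
  N*y²-nonNeg = subst (_≤ N * (y * y)) (*-zeroʳ N) (*-monoˡ-≤-nonNeg N (square-nonNeg y))
  expand : ∀ N A B C x y →
    N * C * (N * C * x * x + (- (N * A) - N * A) * x * y + - B * y * y) ≡
    (N * C * x - N * A * y) * (N * C * x - N * A * y) - (N * (A * A) + B * C) * N * (y * y)
  expand = solve-∀
  unit-sign : ∀ X N y → X * X - -1ℤ * N * (y * y) ≡ X * X + N * (y * y)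
  unit-sign = solve-∀
  completed-square : N * C * eval (formOf (αInt n A B C)) x y ≡ X * X + N * (y * y)
  completed-square = begin-equality
    N * C * eval (formOf (αInt n A B C)) x y     ≡⟨ expand N A B C x y ⟩
    X * X - (N * (A * A) + B * C) * N * (y * y)  ≡⟨ cong (λ u → X * X - u * N * (y * y)) unit ⟩
    X * X - -1ℤ * N * (y * y)                    ≡⟨ unit-sign X N y ⟩
    X * X + N * (y * y)                          ∎

∣B*c⇒∣c : ∀ {N c} A B C → N * (A * A) + B * C ≡ -1ℤ → N ∣ₛ B * c → N ∣ₛ c
∣B*c⇒∣c {N} {c} A B C unit N∣Bc =
  subst (N ∣ₛ_) (neg-involutive c) (∣m⇒∣-m (subst (N ∣ₛ_) ≡-c N∣sum))
  where
  open ≡-Reasoning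
  N∣sum : N ∣ₛ N * (A * A * c) + C * (B * c)
  N∣sum = ∣m∣n⇒∣m+n (∣m⇒∣m*n (A * A * c) ∣-refl) (∣n⇒∣m*n C N∣Bc)
  regroup : ∀ N A B C c → N * (A * A * c) + C * (B * c) ≡ (N * (A * A) + B * C) * c
  regroup = solve-∀
  ≡-c : N * (A * A * c) + C * (B * c) ≡ - c
  ≡-c = begin
    N * (A * A * c) + C * (B * c) ≡⟨ regroup N A B C c ⟩
    (N * (A * A) + B * C) * c     ≡⟨ cong (_* c) unit ⟩
    -1ℤ * c                       ≡⟨ -1*i≡-i c ⟩
    - c                           ∎

commute-αInt⇒∣c : ∀ n A B C A′ B′ C′ γ → + n * (A * A) + B * C ≡ -1ℤ →
                  γ · αInt n A′ B′ C′ ≡ αInt n A B C · γ → + n ∣ₛ c γ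
commute-αInt⇒∣c n A B C A′ B′ C′ (mat a b c d) unit eq =
  ∣B*c⇒∣c A B C unit (divides (a * A′ + b * C′ - A * a) (begin
    B * c                                     ≡⟨ isolate N A B a c ⟩
    (N * A * a + B * c) - N * A * a           ≡⟨ cong (_- N * A * a) (cong Mat.a eq) ⟨
    (a * (N * A′) + b * (N * C′)) - N * A * a ≡⟨ factor N A A′ C′ a b ⟩
    (a * A′ + b * C′ - A * a) * N             ∎))
  where
  open ≡-Reasoning
  N = + n
  isolate : ∀ N A B a c → B * c ≡ (N * A * a + B * c) - N * A * a
  isolate = solve-∀
  factor : ∀ N A A′ C′ a b →
    (a * (N * A′) + b * (N * C′)) - N * A * a ≡ (a * A′ + b * C′ - A * a) * N
  factor = solve-∀

αInt-·-scaled : ∀ n A B C x y z w → let N = + n in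
  αInt n A B C · mat (x * N) y (z * N) (w * N) ≡
  N ⋆ mat (N * A * x + B * z) (A * y + B * w) ((C * x - A * z) * N) (C * y - N * A * w)
αInt-·-scaled n A B C x y z w =
  mat-cong (a-entry N A B x z) (b-entry N A B y w) (c-entry N A C x z) (d-entry N A C y w)
  where
  N = + n
  a-entry : ∀ N A B x z → N * A * (x * N) + B * (z * N) ≡ N * (N * A * x + B * z)
  a-entry = solve-∀
  b-entry : ∀ N A B y w → N * A * y + B * (w * N) ≡ N * (A * y + B * w)
  b-entry = solve-∀
  c-entry : ∀ N A C x z → N * C * (x * N) + - (N * A) * (z * N) ≡ N * ((C * x - A * z) * N)
  c-entry = solve-∀
  d-entry : ∀ N A C y w → N * C * y + - (N * A) * (w * N) ≡ N * (C * y - N * A * w)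
  d-entry = solve-∀

ConjΓ₀⇒ConjFricke : ∀ n M M′ → ConjΓ₀ n M M′ → ConjFricke n M M′
ConjΓ₀⇒ConjFricke n M M′ (δ , δ∈Γ₀ , conj) = ev δ δ∈Γ₀ , conj

ConjFricke⇒ConjΓ₀ : ∀ n .{{_ : ℕ.NonZero n}} A B C A′ B′ C′ → + n * (A * A) + B * C ≡ -1ℤ →
  ConjFricke n (αInt n A B C) (αInt n A′ B′ C′) → ConjΓ₀ n (αInt n A B C) (αInt n A′ B′ C′)
ConjFricke⇒ConjΓ₀ n A B C A′ B′ C′ unit (ev G G∈Γ₀ , conj) = G , G∈Γ₀ , conj
ConjFricke⇒ConjΓ₀ n A B C A′ B′ C′ unit (od (mat g₁ y g₃ g₄) (detG , n∣g₁ , n∣g₃ , n∣g₄) , conj)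
  with ∣ᵤ⇒∣ {+ n} {g₁} n∣g₁ | ∣ᵤ⇒∣ {+ n} {g₃} n∣g₃ | ∣ᵤ⇒∣ {+ n} {g₄} n∣g₄
... | divides x refl | divides z refl | divides w refl =
  δ , (detδ , ∣⇒∣ᵤ (divides (C * x - A * z) refl)) ,
  ConjBy-⋆-cancel N δ M M′ (subst (λ H → ConjBy H M M′) M·G≡N⋆δ (ConjBy-·ˡ G M M′ conj))
  where
  open ≡-Reasoning
  N = + n
  M = αInt n A B C
  M′ = αInt n A′ B′ C′
  G = mat (x * N) y (z * N) (w * N)
  δ = mat (N * A * x + B * z) (A * y + B * w) ((C * x - A * z) * N) (C * y - N * A * w)
  M·G≡N⋆δ : M · G ≡ N ⋆ δ
  M·G≡N⋆δ = αInt-·-scaled n A B C x y z w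
  detδ : det δ ≡ + 1
  detδ = *-cancelˡ-≡ N _ _ (*-cancelˡ-≡ N _ _ (begin
    N * (N * det δ)  ≡⟨ det-⋆ N δ ⟨
    det (N ⋆ δ)      ≡⟨ cong det M·G≡N⋆δ ⟨
    det (M · G)      ≡⟨ det-· M G ⟩
    det M * det G    ≡⟨ cong₂ _*_ (det-αInt n A B C unit) detG ⟩
    N * N            ≡⟨ cong (N *_) (*-identityʳ N) ⟨
    N * (N * + 1)    ∎))

ProperlyEquiv⇒ConjΓ₀ : ∀ n A B C A′ B′ C′ → + n * (A * A) + B * C ≡ -1ℤ →
  ProperlyEquiv (formOf (αInt n A B C)) (formOf (αInt n A′ B′ C′)) →
  ConjΓ₀ n (αInt n A B C) (αInt n A′ B′ C′)
ProperlyEquiv⇒ConjΓ₀ n A B C A′ B′ C′ unit equiv =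
  let γ , detγ , commute = ProperlyEquiv-formOf⇒commute (αInt n A B C) (αInt n A′ B′ C′)
                             (trace-αInt n A B C) (trace-αInt n A′ B′ C′) equiv
  in γ , (detγ , ∣⇒∣ᵤ (commute-αInt⇒∣c n A B C A′ B′ C′ γ unit commute)) , inj₁ commute

¬adj-conj-αInt-negM : ∀ n A B C A′ B′ C′ δ → 0ℤ < + n → + n * (A * A) + B * C ≡ -1ℤ →
  0ℤ < C → 0ℤ < C′ → adj δ · (αInt n A B C · δ) ≢ negM (αInt n A′ B′ C′)
¬adj-conj-αInt-negM n A B C A′ B′ C′ δ 0<n unit 0<C 0<C′ anti =
  <⇒≱ Fδe₁<0 (formOf-αInt-nonNeg n A B C 0<n unit 0<C _ _)
  where
  open ≡-Reasoning
  M = αInt n A B C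
  M′ = αInt n A′ B′ C′
  Fδe₁≡-nC′ : - (+ n * C′) ≡ eval (formOf M) (a δ * + 1 + b δ * 0ℤ) (c δ * + 1 + d δ * 0ℤ)
  Fδe₁≡-nC′ = begin
    - (+ n * C′)                              ≡⟨ eval-formOf-negM M′ ⟨
    eval (formOf (negM M′)) (+ 1) 0ℤ          ≡⟨ cong (λ G → eval (formOf G) (+ 1) 0ℤ) anti ⟨
    eval (formOf (adj δ · (M · δ))) (+ 1) 0ℤ  ≡⟨ eval-formOf-adj-conj δ M (+ 1) 0ℤ ⟩
    eval (formOf M) (a δ * + 1 + b δ * 0ℤ) (c δ * + 1 + d δ * 0ℤ) ∎
  Fδe₁<0 : eval (formOf M) (a δ * + 1 + b δ * 0ℤ) (c δ * + 1 + d δ * 0ℤ) < 0ℤ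
  Fδe₁<0 = subst (_< 0ℤ) Fδe₁≡-nC′ (neg-mono-< (*-pos 0<n 0<C′))

ConjΓ₀⇒ProperlyEquiv : ∀ n A B C A′ B′ C′ → 0ℤ < + n → + n * (A * A) + B * C ≡ -1ℤ →
  0ℤ < C → 0ℤ < C′ → ConjΓ₀ n (αInt n A B C) (αInt n A′ B′ C′) →
  ProperlyEquiv (formOf (αInt n A B C)) (formOf (αInt n A′ B′ C′))
ConjΓ₀⇒ProperlyEquiv n A B C A′ B′ C′ 0<n unit 0<C 0<C′ (δ , (detδ , _) , conj) =
  [ adj-conj⇒ProperlyEquiv δ M M′ detδ
  , (λ anti → ⊥-elim (¬adj-conj-αInt-negM n A B C A′ B′ C′ δ 0<n unit 0<C 0<C′ anti))
  ] (ConjBy⇒adj-conj δ M M′ detδ conj)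
  where
  M = αInt n A B C
  M′ = αInt n A′ B′ C′

lemma2p1 : (n : ℕ) → 1 Data.Nat.< n → (A B C A' B' C' : ℤ) →
    + n * (A * A) + B * C ≡ - + 1 → + n * (A' * A') + B' * C' ≡ - + 1 →
    B < + 0 → B' < + 0 → + 0 < C → + 0 < C' →
    (ProperlyEquiv (Fα n A B C) (Fα n A' B' C') ⇔ ConjFricke n (αInt n A B C) (αInt n A' B' C'))
    × (ConjFricke n (αInt n A B C) (αInt n A' B' C') → ConjΓ₀ n (αInt n A B C) (αInt n A' B' C'))
lemma2p1 n 1<n A B C A′ B′ C′ unit _ _ _ 0<C 0<C′ = mk⇔ toFricke fromFricke , toΓ₀
  where
  M = αInt n A B C
  M′ = αInt n A′ B′ C′
  0<n : 0ℤ < + n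
  0<n = +<+ (ℕₚ.<⇒≤ 1<n)
  instance
    n≢0 : ℕ.NonZero n
    n≢0 = ℕ.>-nonZero (ℕₚ.<⇒≤ 1<n)
  forms : ProperlyEquiv (Fα n A B C) (Fα n A′ B′ C′) ≡ ProperlyEquiv (formOf M) (formOf M′)
  forms = cong₂ ProperlyEquiv (Fα≡formOf-αInt n A B C) (Fα≡formOf-αInt n A′ B′ C′)
  toΓ₀ : ConjFricke n M M′ → ConjΓ₀ n M M′
  toΓ₀ = ConjFricke⇒ConjΓ₀ n A B C A′ B′ C′ unit
  toFricke : ProperlyEquiv (Fα n A B C) (Fα n A′ B′ C′) → ConjFricke n M M′
  toFricke equiv =
    ConjΓ₀⇒ConjFricke n M M′ (ProperlyEquiv⇒ConjΓ₀ n A B C A′ B′ C′ unit (subst id forms equiv))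
  fromFricke : ConjFricke n M M′ → ProperlyEquiv (Fα n A B C) (Fα n A′ B′ C′)
  fromFricke conj =
    subst id (sym forms) (ConjΓ₀⇒ProperlyEquiv n A B C A′ B′ C′ 0<n unit 0<C 0<C′ (toΓ₀ conj))
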